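{- Let $\mathbb{D}=(D,\mathcal{X},I)$ be a linear space such that $|D|=q^2$ for some integer $q>1$, $|\mathcal{X}_p|\le q+1$ for each $p\in D$, and $|D_X|\le q+1$ for each $X\in\mathcal{X}$. If $L\in\mathcal{X}$ satisfies $|D_L|=q+1$, then $D_L\cap D_X\neq\emptyset$ for each $X\in\mathcal{X}$.
   Context: A linear space is an incidence geometry $(D,\mathcal{X},I)$ with point set $D$, line set $\mathcal{X}$ and incidence relation $I\subseteq D\times\mathcal{X}$ such that any two distinct points are incident with exactly one common line, and each line is incident with at least two points. For $p\in D$, $\mathcal{X}_p=\{L\in\mathcal{X}:(p,L)\in I\}$; for $X\in\mathcal{X}$, $D_X=\{a\in D:(a,X)\in I\}$. -}

module Defs where

open import Data.Nat using (ℕ)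
open import Data.Bool using (Bool; T)
open import Data.Fin using (Fin)
open import Data.Fin.Subset using (Subset; inside; outside)
open import Data.Vec using (tabulate)
open import Data.Product using (Σ; _×_; ∃)
open import Relation.Binary.PropositionalEquality using (_≡_; _≢_)
open import Relation.Nullary using (¬_)

-- A finite incidence geometry with n points (Fin n) and m lines (Fin m);
-- incidence is a (decidable) Boolean relation; (p , X) ∈ I  iff  T (I p X).
record LinearSpace (n m : ℕ) : Set where
  field
    I : Fin n → Fin m → Bool
    uniqueLine : ∀ (a b : Fin n) → a ≢ b →
      Σ (Fin m) λ L → (T (I a L) × T (I b L)) ×
        (∀ (L′ : Fin m) → T (I a L′) → T (I b L′) → L′ ≡ L)
    twoPoints : ∀ (X : Fin m) →
      Σ (Fin n) λ a → Σ (Fin n) λ b → a ≢ b × T (I a X) × T (I b X)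

  bool→in : Bool → Data.Fin.Subset.Side
  bool→in Bool.true = inside
  bool→in Bool.false = outside

  linesThrough : Fin n → Subset m
  linesThrough p = tabulate λ X → bool→in (I p X)

  pointsOn : Fin m → Subset n
  pointsOn X = tabulate λ a → bool→in (I a X)

-- If L missed a line X, then from a point p of X the lines joining p to the
-- points of L would be pairwise distinct (two of them coinciding would be L
-- itself, which avoids p) and all different from X, so p would lie on at least
-- |D_L| + 1 = q + 2 lines.
module Submission where

open import Defs
open import Data.Nat using (ℕ; suc; _*_; _≤_; _<_; z≤n)
open import Data.Nat.Properties using (≤-<-trans; <-≤-trans; <-irrefl)
open import Data.Bool using (Bool; true; false; T)
open import Data.Bool.Properties using (T?)
open import Data.Empty using (⊥-elim)
open import Data.Fin using (Fin; zero; suc; _≟_)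
open import Data.Fin.Properties using (any?; suc-injective; 0≢1+n)
open import Data.Fin.Subset using (Subset; inside; outside; _∈_; _-_; ∣_∣)
open import Data.Fin.Subset.Properties using (x∈p∧x≢y⇒x∈p-y; x∈p⇒∣p-x∣<∣p∣)
open import Data.Vec using (_∷_; []; tabulate; here; there)
open import Data.Vec.Properties using (lookup∘tabulate; lookup⇒[]=; []=⇒lookup)
open import Data.Product using (Σ; _×_; _,_; proj₁; proj₂)
open import Relation.Binary.PropositionalEquality using (_≡_; _≢_; refl; sym; trans; subst)
open import Relation.Nullary using (¬_; yes; no)
open import Relation.Nullary.Decidable using (_×-dec_)

injectiveOn⇒∣p∣≤∣q∣ : ∀ {n m} {p : Subset n} {q : Subset m}
  (f : ∀ {x} → x ∈ p → Fin m) →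
  (∀ {x} (x∈p : x ∈ p) → f x∈p ∈ q) →
  (∀ {x y} (x∈p : x ∈ p) (y∈p : y ∈ p) → f x∈p ≡ f y∈p → x ≡ y) →
  ∣ p ∣ ≤ ∣ q ∣
injectiveOn⇒∣p∣≤∣q∣ {p = []} f maps inj = z≤n
injectiveOn⇒∣p∣≤∣q∣ {p = outside ∷ p} f maps inj =
  injectiveOn⇒∣p∣≤∣q∣ (λ x∈p → f (there x∈p)) (λ x∈p → maps (there x∈p))
    (λ x∈p y∈p e → suc-injective (inj (there x∈p) (there y∈p) e))
injectiveOn⇒∣p∣≤∣q∣ {p = inside ∷ p} {q} f maps inj =
  ≤-<-trans (injectiveOn⇒∣p∣≤∣q∣ (λ x∈p → f (there x∈p)) mapsAway injTail)
            (x∈p⇒∣p-x∣<∣p∣ (maps here))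
  where
  mapsAway : ∀ {x} (x∈p : x ∈ p) → f (there x∈p) ∈ q - f here
  mapsAway x∈p = x∈p∧x≢y⇒x∈p-y (maps (there x∈p)) (λ e → 0≢1+n (inj here (there x∈p) (sym e)))
  injTail : ∀ {x y} (x∈p : x ∈ p) (y∈p : y ∈ p) → f (there x∈p) ≡ f (there y∈p) → x ≡ y
  injTail x∈p y∈p e = suc-injective (inj (there x∈p) (there y∈p) e)

module _ {n m : ℕ} (S : LinearSpace n m) where
  open LinearSpace S

  ∈-tabulate⁺ : ∀ {k} (f : Fin k → Bool) {x} → T (f x) → x ∈ tabulate (λ y → bool→in (f y))
  ∈-tabulate⁺ f {x} fx = lookup⇒[]= x _ (trans (lookup∘tabulate _ x) (inside-if-T fx))
    where
    inside-if-T : ∀ {b} → T b → bool→in b ≡ inside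
    inside-if-T {true} _ = refl

  ∈-tabulate⁻ : ∀ {k} (f : Fin k → Bool) {x} → x ∈ tabulate (λ y → bool→in (f y)) → T (f x)
  ∈-tabulate⁻ f {x} x∈ = T-if-inside (trans (sym (lookup∘tabulate _ x)) ([]=⇒lookup x∈))
    where
    T-if-inside : ∀ {b} → bool→in b ≡ inside → T b
    T-if-inside {true} _ = _
    T-if-inside {false} ()

  join : {a b : Fin n} → a ≢ b → Fin m
  join a≢b = proj₁ (uniqueLine _ _ a≢b)

  module _ {a b : Fin n} (a≢b : a ≢ b) where

    join-incidentˡ : T (I a (join a≢b))
    join-incidentˡ = proj₁ (proj₁ (proj₂ (uniqueLine a b a≢b)))

    join-incidentʳ : T (I b (join a≢b))
    join-incidentʳ = proj₂ (proj₁ (proj₂ (uniqueLine a b a≢b)))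

    join-unique : ∀ {M} → T (I a M) → T (I b M) → M ≡ join a≢b
    join-unique {M} = proj₂ (proj₂ (uniqueLine a b a≢b)) M

  pointOn : Fin m → Fin n
  pointOn X = proj₁ (twoPoints X)

  pointOn-incident : ∀ X → T (I (pointOn X) X)
  pointOn-incident X = proj₁ (proj₂ (proj₂ (proj₂ (twoPoints X))))

  Disjoint : Fin m → Fin m → Set
  Disjoint L X = ∀ a → T (I a L) → ¬ T (I a X)

  ∣pointsOn∣<∣linesThrough∣ : ∀ {L X p} → Disjoint L X → T (I p X) →
    ∣ pointsOn L ∣ < ∣ linesThrough p ∣
  ∣pointsOn∣<∣linesThrough∣ {L} {X} {p} L∩X≡∅ pX =
    ≤-<-trans (injectiveOn⇒∣p∣≤∣q∣ lineToL lineToL∈ lineToL-injective)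
              (x∈p⇒∣p-x∣<∣p∣ (∈-tabulate⁺ (I p) pX))
    where
    onL : ∀ {a} → a ∈ pointsOn L → T (I a L)
    onL = ∈-tabulate⁻ (λ a → I a L)

    p≢ : ∀ {a} → a ∈ pointsOn L → p ≢ a
    p≢ a∈L refl = L∩X≡∅ p (onL a∈L) pX

    lineToL : ∀ {a} → a ∈ pointsOn L → Fin m
    lineToL a∈L = join (p≢ a∈L)

    lineToL∈ : ∀ {a} (a∈L : a ∈ pointsOn L) → lineToL a∈L ∈ linesThrough p - X
    lineToL∈ {a} a∈L = x∈p∧x≢y⇒x∈p-y (∈-tabulate⁺ (I p) (join-incidentˡ (p≢ a∈L))) ≢X
      where
      ≢X : lineToL a∈L ≢ X
      ≢X e = L∩X≡∅ a (onL a∈L) (subst (λ M → T (I a M)) e (join-incidentʳ (p≢ a∈L)))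

    -- Two points of L on one line through p force that line to be L, yet p ∉ L.
    lineToL-injective : ∀ {a b} (a∈L : a ∈ pointsOn L) (b∈L : b ∈ pointsOn L) →
      lineToL a∈L ≡ lineToL b∈L → a ≡ b
    lineToL-injective {a} {b} a∈L b∈L e with a ≟ b
    ... | yes a≡b = a≡b
    ... | no a≢b = ⊥-elim (L∩X≡∅ p (subst (λ M → T (I p M)) (sym L≡pa) (join-incidentˡ (p≢ a∈L))) pX)
      where
      bOnPa : T (I b (lineToL a∈L))
      bOnPa = subst (λ M → T (I b M)) (sym e) (join-incidentʳ (p≢ b∈L))
      L≡pa : L ≡ lineToL a∈L
      L≡pa = trans (join-unique a≢b (onL a∈L) (onL b∈L))
                   (sym (join-unique a≢b (join-incidentʳ (p≢ a∈L)) bOnPa))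

  meets-all-if-∣pointsOn∣≡maxDegree : ∀ {k} → (∀ p → ∣ linesThrough p ∣ ≤ k) →
    ∀ {L} → ∣ pointsOn L ∣ ≡ k → ∀ X → Σ (Fin n) λ a → T (I a L) × T (I a X)
  meets-all-if-∣pointsOn∣≡maxDegree {k} degree≤k {L} ∣L∣≡k X
    with any? (λ a → T? (I a L) ×-dec T? (I a X))
  ... | yes common = common
  ... | no noCommon = ⊥-elim (<-irrefl refl (<-≤-trans k<degree (degree≤k (pointOn X))))
    where
    k<degree : k < ∣ linesThrough (pointOn X) ∣
    k<degree = subst (_< _) ∣L∣≡k
      (∣pointsOn∣<∣linesThrough∣ (λ a aL aX → noCommon (a , aL , aX)) (pointOn-incident X))

lemma1p3 : (q : ℕ) → 1 < q → (m : ℕ) → (S : LinearSpace (q * q) m) →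
    (∀ (p : Fin (q * q)) → ∣ LinearSpace.linesThrough S p ∣ ≤ suc q) →
    (∀ (X : Fin m) → ∣ LinearSpace.pointsOn S X ∣ ≤ suc q) →
    (L : Fin m) → ∣ LinearSpace.pointsOn S L ∣ ≡ suc q →
    (X : Fin m) →
    Σ (Fin (q * q)) λ a → T (LinearSpace.I S a L) × T (LinearSpace.I S a X)
lemma1p3 q _ m S linesPerPoint _ L ∣L∣≡q+1 =
  meets-all-if-∣pointsOn∣≡maxDegree S linesPerPoint ∣L∣≡q+1
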